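{- For every $\varphi\in\mathcal{L}_n$, $\varphi$ is valid on every weakly directed equivalence frame iff $\varphi$ is valid on every directed equivalence frame.
   Context: $\mathcal{L}_n$: $\varphi::=p\mid\neg\varphi\mid\varphi\wedge\varphi\mid\Box_i\varphi$ ($i=1,\dots,n$), standard Kripke semantics on frames $(W,\sim_1,\dots,\sim_n)$, $W$ nonempty; valid on a frame = true at all worlds under all valuations. Equivalence frame: all $\sim_i$ equivalence relations. Directed: for any $w_1,\dots,w_n\in W$ there is $w$ with $w_i\sim_iw$ for all $i$. Weakly directed: for all $w_0,\dots,w_n\in W$, if for each $i$ there is $j$ with $w_0\sim_jw_i$, then there is $w$ with $w_i\sim_iw$ for all $i$. -}

module Defs where

open import Data.Nat using (ℕ)
open import Data.Fin using (Fin)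
open import Data.Product using (Σ; ∃; _×_)
open import Data.Empty using (⊥)
open import Relation.Binary.Definitions using (Reflexive; Symmetric; Transitive)
open import Level using (suc; zero)

data Form (n : ℕ) : Set where
  var  : ℕ → Form n
  ¬'_  : Form n → Form n
  _∧'_ : Form n → Form n → Form n
  □    : Fin n → Form n → Form n

record Frame (n : ℕ) : Set₁ where
  field
    W   : Set
    R   : Fin n → W → W → Set
    inhabitant : W

open Frame public

Valuation : ∀ {n} → Frame n → Set₁
Valuation F = ℕ → W F → Set

_,_,_⊨_ : ∀ {n} (F : Frame n) → Valuation F → W F → Form n → Set
F , V , w ⊨ var p    = V p w
F , V , w ⊨ (¬' φ)   = F , V , w ⊨ φ → ⊥
F , V , w ⊨ (φ ∧' ψ) = (F , V , w ⊨ φ) × (F , V , w ⊨ ψ)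
F , V , w ⊨ □ i φ    = ∀ v → R F i w v → F , V , v ⊨ φ

ValidOn : ∀ {n} → Form n → Frame n → Set₁
ValidOn φ F = (V : Valuation F) (w : W F) → F , V , w ⊨ φ

EquivFrame : ∀ {n} → Frame n → Set
EquivFrame {n} F = (i : Fin n) →
  Reflexive (R F i) × Symmetric (R F i) × Transitive (R F i)

Directed : ∀ {n} → Frame n → Set
Directed {n} F = (ws : Fin n → W F) → Σ (W F) λ w → (i : Fin n) → R F i (ws i) w

WeaklyDirected : ∀ {n} → Frame n → Set
WeaklyDirected {n} F = (w₀ : W F) (ws : Fin n → W F) →
  ((i : Fin n) → Σ (Fin n) λ j → R F j w₀ (ws i)) →
  Σ (W F) λ w → (i : Fin n) → R F i (ws i) w

{-# OPTIONS --safe #-}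
module Submission where

-- Call x anchored at b if every ~ᵢ-class of x contains a world adjacent to b,
-- i.e. j-related to b for some agent j. Weak directedness makes the worlds
-- anchored at b closed under every ~ₖ, so they carry a generated subframe,
-- which preserves truth. Applying weak directedness at b to the adjacent
-- witnesses chosen in the classes of w₁, …, wₙ shows that this subframe is
-- directed. Hence a formula valid on directed equivalence frames holds at
-- every world b of a weakly directed one; the converse is immediate since
-- directed frames are weakly directed.

open import Defs
open import Data.Nat using (ℕ)
open import Data.Fin using (Fin; _≟_)
open import Data.Product using (Σ; _×_; _,_; proj₁; proj₂)
open import Data.Product.Function.NonDependent.Propositional using (_×-⇔_)
open import Data.Empty using (⊥-elim)
open import Function using (id)
open import Function.Bundles using (_⇔_; mk⇔; Equivalence)
open import Function.Related.TypeIsomorphisms using (¬-cong-⇔)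
open import Relation.Nullary using (yes; no)
open import Relation.Binary.PropositionalEquality using (_≢_; refl; sym; ≢-sym)

open Equivalence using (to; from)

directed⇒weaklyDirected : ∀ {n} (F : Frame n) → Directed F → WeaklyDirected F
directed⇒weaklyDirected F directed _ ws _ = directed ws

Closed : ∀ {n} (F : Frame n) → (W F → Set) → Set
Closed {n} F P = ∀ (i : Fin n) {x y} → R F i x y → P x → P y

module _ {n} (F : Frame n) (P : W F → Set) (a₀ : Σ (W F) P) where

  restrict : Frame n
  restrict = record
    { W          = Σ (W F) P
    ; R          = λ i a b → R F i (proj₁ a) (proj₁ b)
    ; inhabitant = a₀
    }

  restrictValuation : Valuation F → Valuation restrict
  restrictValuation V p a = V p (proj₁ a)

  restrict-equiv : EquivFrame F → EquivFrame restrict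
  restrict-equiv equiv i =
    proj₁ (equiv i) , proj₁ (proj₂ (equiv i)) , proj₂ (proj₂ (equiv i))

  module _ (closed : Closed F P) (V : Valuation F) where

    ⊨-restrict : ∀ φ (a : Σ (W F) P) →
      (restrict , restrictValuation V , a ⊨ φ) ⇔ (F , V , proj₁ a ⊨ φ)
    ⊨-restrict (var p)  a = mk⇔ id id
    ⊨-restrict (¬' φ)   a = ¬-cong-⇔ (⊨-restrict φ a)
    ⊨-restrict (φ ∧' ψ) a = ⊨-restrict φ a ×-⇔ ⊨-restrict ψ a
    ⊨-restrict (□ i φ)  (x , px) = mk⇔
      (λ h y r → to (⊨-restrict φ (y , closed i r px)) (h (y , closed i r px) r))
      (λ h b r → from (⊨-restrict φ b) (h (proj₁ b) r))

    valid-restrict : ∀ φ → ValidOn φ restrict → (a : Σ (W F) P) → F , V , proj₁ a ⊨ φ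
    valid-restrict φ valid a = to (⊨-restrict φ a) (valid (restrictValuation V) a)

Adjacent : ∀ {n} (F : Frame n) → W F → W F → Set
Adjacent {n} F b x = Σ (Fin n) λ j → R F j b x

Anchored : ∀ {n} (F : Frame n) → W F → W F → Set
Anchored {n} F b x = (i : Fin n) → Σ (W F) λ x′ → R F i x x′ × Adjacent F b x′

module WeaklyDirectedEquivFrame {n} (F : Frame n) (equiv : EquivFrame F)
                                (weaklyDirected : WeaklyDirected F) where

  ~-refl : ∀ i {x} → R F i x x
  ~-refl i = proj₁ (equiv i)

  ~-sym : ∀ i {x y} → R F i x y → R F i y x
  ~-sym i = proj₁ (proj₂ (equiv i))

  ~-trans : ∀ i {x y z} → R F i x y → R F i y z → R F i x z
  ~-trans i = proj₂ (proj₂ (equiv i))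

  join-adjacent : ∀ {b x y} {i m : Fin n} → i ≢ m → Adjacent F b x → Adjacent F b y →
                  Σ (W F) λ z → R F i x z × R F m y z
  join-adjacent {b} {x} {y} {i} {m} i≢m bx by =
    let z , ws~z = weaklyDirected b ws ws-adjacent in z , from-x (ws~z i) , from-y (ws~z m)
    where
    ws : Fin n → W F
    ws k with k ≟ i
    ... | yes _ = x
    ... | no  _ = y

    ws-adjacent : ∀ k → Adjacent F b (ws k)
    ws-adjacent k with k ≟ i
    ... | yes _ = bx
    ... | no  _ = by

    from-x : ∀ {z} → R F i (ws i) z → R F i x z
    from-x r with i ≟ i
    ... | yes _   = r
    ... | no  i≢i = ⊥-elim (i≢i refl)

    from-y : ∀ {z} → R F m (ws m) z → R F m y z
    from-y r with m ≟ i
    ... | yes m≡i = ⊥-elim (i≢m (sym m≡i))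
    ... | no  _   = r

  anchored-refl : ∀ {b} → Anchored F b b
  anchored-refl i = _ , ~-refl i , i , ~-refl i

  anchored-closed : ∀ {b} → Closed F (Anchored F b)
  anchored-closed k x~y anchored i with anchored k | k ≟ i
  ... | x′ , x~x′ , b~x′ | yes refl = x′ , ~-trans k (~-sym k x~y) x~x′ , b~x′
  ... | x′ , x~x′ , j , b~x′ | no k≢i
    with join-adjacent (≢-sym k≢i) (k , ~-trans k (~-sym k x~x′) x~y)
                                          (j , ~-sym j b~x′)
  ... | z , y~z , b~z = z , y~z , k , b~z

  anchored-adjacent : ∀ {b x} → Adjacent F b x → Anchored F b x
  anchored-adjacent (j , b~x) = anchored-closed j b~x anchored-refl

  AnchoredSubframe : W F → Frame n
  AnchoredSubframe b = restrict F (Anchored F b) (b , anchored-refl)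

  anchoredSubframe-equiv : ∀ b → EquivFrame (AnchoredSubframe b)
  anchoredSubframe-equiv b = restrict-equiv F (Anchored F b) (b , anchored-refl) equiv

  anchoredSubframe-directed : ∀ b → Directed (AnchoredSubframe b)
  anchoredSubframe-directed b ws =
    let z , w′~z = weaklyDirected b w′ b~w′ in
    (z , λ i → anchored-closed i (w′~z i) (anchored-adjacent (b~w′ i)) i) ,
    λ i → ~-trans i (w~w′ i) (w′~z i)
    where
    w′ : Fin n → W F
    w′ i = proj₁ (proj₂ (ws i) i)
    w~w′ : ∀ i → R F i (proj₁ (ws i)) (w′ i)
    w~w′ i = proj₁ (proj₂ (proj₂ (ws i) i))
    b~w′ : ∀ i → Adjacent F b (w′ i)
    b~w′ i = proj₂ (proj₂ (proj₂ (ws i) i))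

corollary3p3 : (n : ℕ) (φ : Form n) →
    (((F : Frame n) → EquivFrame F → WeaklyDirected F → ValidOn φ F) →
      ((F : Frame n) → EquivFrame F → Directed F → ValidOn φ F))
    × (((F : Frame n) → EquivFrame F → Directed F → ValidOn φ F) →
      ((F : Frame n) → EquivFrame F → WeaklyDirected F → ValidOn φ F))
corollary3p3 n φ =
  (λ valid F equiv directed → valid F equiv (directed⇒weaklyDirected F directed)) ,
  λ valid F equiv weaklyDirected V b →
    let open WeaklyDirectedEquivFrame F equiv weaklyDirected in
    valid-restrict F (Anchored F b) _ anchored-closed V φ
      (valid (AnchoredSubframe b) (anchoredSubframe-equiv b) (anchoredSubframe-directed b))
      (b , anchored-refl)
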